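{- Let $X$ be a shift space and $k\ge1$. The $k$-th higher block shift space $X^{(k)}$ is eventually dendric if and only if $X$ is eventually dendric.
   Context: A shift space on a finite alphabet $A$ is a closed shift-invariant subset of $A^{\mathbb Z}$; $\mathcal L(X)$ is its set of finite factors, $\mathcal L_k(X)$ those of length $k$, $\mathcal L_{\ge n}(X)$ those of length at least $n$. For $w\in\mathcal L(X)$, $\mathcal E_1(w)$ is the undirected bipartite graph with vertex set the disjoint union of $L_1(w)=\{a\in A:aw\in\mathcal L(X)\}$ and $R_1(w)=\{b\in A:wb\in\mathcal L(X)\}$ and edges the pairs $(a,b)$ with $awb\in\mathcal L(X)$; $X$ is eventually dendric if for some $m\ge0$ all $\mathcal E_1(w)$, $w\in\mathcal L_{\ge m}(X)$, are trees. Let $f:\mathcal L_k(X)\to A_k$ be a bijection onto an alphabet $A_k$. The $k$-th higher block code $\gamma_k:X\to A_k^{\mathbb Z}$ is defined by $\gamma_k(x)_n=f(x_n\cdots x_{n+k-1})$ for all $n\in\mathbb Z$, and $X^{(k)}=\gamma_k(X)$ is the $k$-th higher block shift space. -}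

module Defs where

open import Level using (Level; suc; _⊔_) renaming (zero to 0ℓ)
open import Data.Nat as ℕ using (ℕ; _≤_)
open import Data.Integer as ℤ using (ℤ)
open import Data.Fin using (Fin; toℕ)
open import Data.List using (List; []; _∷_; _++_; [_]; length; map; upTo)
open import Data.List.Relation.Unary.All using (All)
open import Data.List.Relation.Unary.Linked using (Linked)
open import Data.List.Relation.Unary.Unique.Propositional using (Unique)
open import Data.Vec using (Vec; tabulate)
open import Data.Product using (Σ; _×_; _,_)
open import Data.Sum using (_⊎_; inj₁; inj₂)
open import Data.Empty using (⊥)
open import Relation.Nullary using (¬_)
open import Relation.Binary.PropositionalEquality using (_≡_)

Config : Set → Set
Config A = ℤ → A

σ : {A : Set} → Config A → Config A
σ x i = x (i ℤ.+ ℤ.+ 1)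

σ⁻¹ : {A : Set} → Config A → Config A
σ⁻¹ x i = x (i ℤ.- ℤ.+ 1)

window : {A : Set} → Config A → ℤ → ℕ → List A
window x i m = map (λ j → x (i ℤ.+ ℤ.+ j)) (upTo m)

Subshift-like : Set → Set₁
Subshift-like A = Config A → Set

Lang : {A : Set} → Subshift-like A → List A → Set
Lang P w = Σ (Config _) λ x → P x × Σ ℤ λ i → window x i (length w) ≡ w

-- A shift space: closed shift-invariant subset of A^ℤ.
-- Closedness (product topology): a point all of whose (centred) windows are
-- factors of points of X lies in X.
record ShiftSpace (A : Set) : Set₁ where
  field
    carrier   : Subshift-like A
    shift-inv : ∀ x → carrier x → carrier (σ x)
    shift-inv⁻¹ : ∀ x → carrier x → carrier (σ⁻¹ x)
    closed    : ∀ x → (∀ (n : ℕ) → Lang carrier (window x (ℤ.- ℤ.+ n) (n ℕ.+ n ℕ.+ 1)) )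
                    → carrier x

record Graph (V : Set) : Set₁ where
  field
    Vert : V → Set
    Adj  : V → V → Set

module _ {V : Set} (G : Graph V) where
  open Graph G

  data Walk : V → V → Set where
    here : ∀ {v} → Vert v → Walk v v
    step : ∀ {u v w} → Vert u → Adj u v → Walk v w → Walk u w

  Connected : Set
  Connected = ∀ u v → Vert u → Vert v → Walk u v

  -- a cycle: distinct vertices v₀ … v_{n-1}, n ≥ 3, with v_i ~ v_{i+1} and v_{n-1} ~ v₀
  Cycle : Set
  Cycle = Σ V λ v → Σ (List V) λ vs →
            (2 ≤ length vs) × All Vert (v ∷ vs) ×
            Unique (v ∷ vs) × Linked Adj (v ∷ vs ++ [ v ])

  Acyclic : Set
  Acyclic = ¬ Cycle

  IsTree : Set
  IsTree = Connected × Acyclic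

module _ {A : Set} (P : Subshift-like A) (w : List A) where

  L₁ : A → Set
  L₁ a = Lang P (a ∷ w)

  R₁ : A → Set
  R₁ b = Lang P (w ++ [ b ])

  E₁-edge : A → A → Set
  E₁-edge a b = Lang P (a ∷ w ++ [ b ])

  E₁-Vert : A ⊎ A → Set
  E₁-Vert (inj₁ a) = L₁ a
  E₁-Vert (inj₂ b) = R₁ b

  E₁-Adj : A ⊎ A → A ⊎ A → Set
  E₁-Adj (inj₁ a) (inj₂ b) = E₁-edge a b
  E₁-Adj (inj₂ b) (inj₁ a) = E₁-edge a b
  E₁-Adj (inj₁ _) (inj₁ _) = ⊥
  E₁-Adj (inj₂ _) (inj₂ _) = ⊥

  E₁ : Graph (A ⊎ A)
  E₁ = record { Vert = E₁-Vert ; Adj = E₁-Adj }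

EventuallyDendric : {A : Set} → Subshift-like A → Set
EventuallyDendric P = Σ ℕ λ m → ∀ (w : List _) → m ≤ length w → Lang P w → IsTree (E₁ P w)

γ : {A : Set} (k : ℕ) → Config A → Config (Vec A k)
γ k x i = tabulate (λ (j : Fin k) → x (i ℤ.+ ℤ.+ toℕ j))

HigherBlock : {A : Set} (k : ℕ) → ShiftSpace A → Subshift-like (Vec A k)
HigherBlock k X y = Σ (Config _) λ x → ShiftSpace.carrier X x × (∀ i → y i ≡ γ k x i)

module Submission where

-- Write k = j + 1 and let P be any set of configurations over A.  On finite words, γ_k acts as the
-- sliding block code `blocks`, which lists the factors of length k of a word;
-- it is injective on words of length ≥ k, and the language of the block image
-- γ_k(P) consists exactly of the words `blocks u` with u ∈ L(P), |u| ≥ j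
-- (with u unique once |u| ≥ k).
-- The heart of the proof: for every word u of length ≥ k, the extension graph
-- E₁(u) in P is isomorphic to E₁(blocks u) in γ_k(P), via a ↦ a·p on left
-- extensions and b ↦ s·b on right extensions, where p and s are the prefix and
-- the suffix of length j of u.  Since graph isomorphisms preserve trees and
-- `blocks` shortens words by exactly j, eventual dendricity transfers in both
-- directions with thresholds shifted by a constant.

open import Defs
open import Data.Nat using (ℕ; zero; suc; _+_; _≤_; _<_; z≤n; s≤s)
open import Data.Nat.Properties
  using (≤-refl; ≤-reflexive; ≤-trans; n≤1+n; m≤n⇒m<n∨m≡n; suc-injective; m≤n+m; m≤m+n; +-monoˡ-≤; +-monoʳ-≤; +-cancelʳ-≤)
import Data.Integer as ℤ
import Data.Integer.Properties as ℤ
open import Data.Fin using (Fin; toℕ)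
open import Data.Maybe using (Maybe; just; nothing)
import Data.Maybe as Maybe
open import Data.List using (List; []; _∷_; _++_; [_]; length; map; upTo; applyUpTo)
open import Data.List.Properties
  using (map-++; length-map; length-++-sucʳ; ++-identityʳ; ∷-injective; ∷ʳ-injective; ∷ʳ-injectiveʳ; map-cong; map-upTo; length-upTo; length-++-≤ˡ)
open import Data.List.Reverse using (reverseView; []; _∶_∶ʳ_)
open import Data.List.Relation.Unary.All using (All; []; _∷_)
open import Data.List.Relation.Unary.All.Properties using (++⁺)
open import Data.List.Relation.Unary.AllPairs using ([]; _∷_)
open import Data.List.Relation.Unary.Linked using (Linked; []; [-]; _∷_)
open import Data.List.Relation.Unary.Unique.Propositional using (Unique)
open import Data.Vec using (Vec; _∷ʳ_; head; last; toList) renaming ([] to []ᵥ; _∷_ to _∷ᵥ_)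
open import Data.Vec.Properties using (last-∷ʳ; tabulate-cong) renaming (∷ʳ-injectiveˡ to vec-∷ʳ-injectiveˡ)
open import Data.Product using (Σ; _×_; _,_; proj₁; proj₂)
open import Data.Sum using (_⊎_; inj₁; inj₂)
open import Function using (_∘_)
open import Function.Bundles using (_⇔_; mk⇔)
open import Relation.Binary.PropositionalEquality using (_≡_; _≢_; refl; sym; trans; cong; cong₂; subst; subst₂)
open Relation.Binary.PropositionalEquality.≡-Reasoning

record GraphIso {V W : Set} (G : Graph V) (H : Graph W) : Set where
  open Graph G renaming (Vert to VertG; Adj to AdjG)
  open Graph H renaming (Vert to VertH; Adj to AdjH)
  field
    to        : V → W
    from      : W → V
    to-vert   : ∀ {a} → VertG a → VertH (to a)
    from-vert : ∀ {b} → VertH b → VertG (from b)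
    from-to   : ∀ {a} → VertG a → from (to a) ≡ a
    to-from   : ∀ {b} → VertH b → to (from b) ≡ b
    to-adj    : ∀ {a a′} → VertG a → VertG a′ → AdjG a a′ → AdjH (to a) (to a′)
    from-adj  : ∀ {b b′} → VertH b → VertH b′ → AdjH b b′ → AdjG (from b) (from b′)

GraphIso-sym : ∀ {V W} {G : Graph V} {H : Graph W} → GraphIso G H → GraphIso H G
GraphIso-sym I = record
  { to = from ; from = to ; to-vert = from-vert ; from-vert = to-vert
  ; from-to = to-from ; to-from = from-to ; to-adj = from-adj ; from-adj = to-adj }
  where open GraphIso I

-- Being a tree is invariant under isomorphism: walks are carried forward
-- along `to`, and a cycle of H is carried back along `from`, which stays
-- injective on the vertices of H because `to` is a left inverse there.
module _ {V W : Set} {G : Graph V} {H : Graph W} (I : GraphIso G H) where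
  open GraphIso I
  open Graph G renaming (Vert to VertG; Adj to AdjG)
  open Graph H renaming (Vert to VertH; Adj to AdjH)

  walk-start : ∀ {a b} → Walk G a b → VertG a
  walk-start (here v)     = v
  walk-start (step v _ _) = v

  map-walk : ∀ {a b} → Walk G a b → Walk H (to a) (to b)
  map-walk (here v)     = here (to-vert v)
  map-walk (step v e w) = step (to-vert v) (to-adj v (walk-start w) e) (map-walk w)

  connected-transport : Connected G → Connected H
  connected-transport c u v u∈ v∈ =
    subst₂ (Walk H) (to-from u∈) (to-from v∈) (map-walk (c _ _ (from-vert u∈) (from-vert v∈)))

  map-vertices : ∀ {bs} → All VertH bs → All VertG (map from bs)
  map-vertices []         = []
  map-vertices (b∈ ∷ bs∈) = from-vert b∈ ∷ map-vertices bs∈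

  from-injective : ∀ {b b′} → VertH b → VertH b′ → from b ≡ from b′ → b ≡ b′
  from-injective b∈ b′∈ eq = trans (sym (to-from b∈)) (trans (cong to eq) (to-from b′∈))

  map-distinct : ∀ {b cs} → VertH b → All VertH cs →
                 All (b ≢_) cs → All (from b ≢_) (map from cs)
  map-distinct b∈ []         []           = []
  map-distinct b∈ (c∈ ∷ cs∈) (b≢c ∷ b≢cs) =
    (λ eq → b≢c (from-injective b∈ c∈ eq)) ∷ map-distinct b∈ cs∈ b≢cs

  map-unique : ∀ {bs} → All VertH bs → Unique bs → Unique (map from bs)
  map-unique []         []           = []
  map-unique (b∈ ∷ bs∈) (b∉bs ∷ bs!) = map-distinct b∈ bs∈ b∉bs ∷ map-unique bs∈ bs!

  map-linked : ∀ {bs} → All VertH bs → Linked AdjH bs → Linked AdjG (map from bs)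
  map-linked []                []      = []
  map-linked (_ ∷ [])          [-]     = [-]
  map-linked (b∈ ∷ c∈ ∷ cs∈) (e ∷ l) = from-adj b∈ c∈ e ∷ map-linked (c∈ ∷ cs∈) l

  acyclic-transport : Acyclic G → Acyclic H
  acyclic-transport no-cycle (v , vs , 2≤ , v∷vs∈ , v∷vs! , closed) =
    no-cycle ( from v , map from vs
             , subst (2 ≤_) (sym (length-map from vs)) 2≤
             , map-vertices v∷vs∈
             , map-unique v∷vs∈ v∷vs!
             , subst (Linked AdjG) (cong (from v ∷_) (map-++ from vs [ v ]))
                 (map-linked (close v∷vs∈) closed) )
    where
    close : ∀ {bs} → All VertH (v ∷ bs) → All VertH (v ∷ bs ++ [ v ])
    close (v∈ ∷ bs∈) = v∈ ∷ ++⁺ bs∈ (v∈ ∷ [])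

  tree-transport : IsTree G → IsTree H
  tree-transport (c , a) = connected-transport c , acyclic-transport a

length-snoc : ∀ {A : Set} (u : List A) c → length (u ++ [ c ]) ≡ suc (length u)
length-snoc u c = trans (length-++-sucʳ u c []) (cong (suc ∘ length) (++-identityʳ u))

module _ {A : Set} where

  prefix : (m : ℕ) → List A → Maybe (Vec A m)
  prefix zero    _       = just []ᵥ
  prefix (suc m) []      = nothing
  prefix (suc m) (a ∷ u) = Maybe.map (a ∷ᵥ_) (prefix m u)

  prefix-∷ : ∀ {m} a u {p} → prefix m u ≡ just p → prefix (suc m) (a ∷ u) ≡ just (a ∷ᵥ p)
  prefix-∷ a u eq rewrite eq = refl

  prefix-just : ∀ m u → m ≤ length u → Σ (Vec A m) λ p → prefix m u ≡ just p
  prefix-just zero    u       _         = []ᵥ , refl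
  prefix-just (suc m) (a ∷ u) (s≤s m≤u) with prefix-just m u m≤u
  ... | p , eq = a ∷ᵥ p , prefix-∷ a u eq

  prefix-nothing : ∀ m u → length u < m → prefix m u ≡ nothing
  prefix-nothing (suc m) []      _         = refl
  prefix-nothing (suc m) (a ∷ u) (s≤s u<m) rewrite prefix-nothing m u u<m = refl

  prefix-++ : ∀ m u r {p} → prefix m u ≡ just p → prefix m (u ++ r) ≡ just p
  prefix-++ zero    u       r eq = eq
  prefix-++ (suc m) (a ∷ u) r eq with prefix m u in e
  ... | just q rewrite prefix-++ m u r e = eq

  prefix-whole : ∀ m u {p} → length u ≡ m → prefix m u ≡ just p → u ≡ toList p
  prefix-whole zero    []      _   refl = refl
  prefix-whole (suc m) (a ∷ u) len eq with prefix m u in e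
  prefix-whole (suc m) (a ∷ u) len refl | just q =
    cong (a ∷_) (prefix-whole m u (suc-injective len) e)

  prefix-∷ʳ : ∀ m u c {p} → length u ≡ m → prefix m u ≡ just p →
              prefix (suc m) (u ++ [ c ]) ≡ just (p ∷ʳ c)
  prefix-∷ʳ zero    []      c _   refl = refl
  prefix-∷ʳ (suc m) (a ∷ u) c len eq with prefix m u in e
  prefix-∷ʳ (suc m) (a ∷ u) c len refl | just q
    rewrite prefix-∷ʳ m u c (suc-injective len) e = refl

module Blocks {A : Set} (j : ℕ) where

  blocks : List A → List (Vec A (suc j))
  blocks []      = []
  blocks (a ∷ u) with prefix (suc j) (a ∷ u)
  ... | just v  = v ∷ blocks u
  ... | nothing = []

  blocks-∷ : ∀ a u {v} → prefix (suc j) (a ∷ u) ≡ just v → blocks (a ∷ u) ≡ v ∷ blocks u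
  blocks-∷ a u eq rewrite eq = refl

  blocks-short : ∀ u → length u ≤ j → blocks u ≡ []
  blocks-short []      _   = refl
  blocks-short (a ∷ u) u≤j rewrite prefix-nothing j u u≤j = refl

  blocks-exact : ∀ u {v} → length u ≡ suc j → prefix (suc j) u ≡ just v → blocks u ≡ [ v ]
  blocks-exact (a ∷ u) len eq =
    trans (blocks-∷ a u eq) (cong (_ ∷_) (blocks-short u (subst (_≤ j) (sym (suc-injective len)) ≤-refl)))

  length-blocks : ∀ u → j ≤ length u → length (blocks u) + j ≡ length u
  length-blocks []      z≤n = refl
  length-blocks (a ∷ u) j≤  with m≤n⇒m<n∨m≡n j≤
  ... | inj₂ refl rewrite blocks-short (a ∷ u) ≤-refl = refl
  ... | inj₁ (s≤s j≤u) with prefix-just j u j≤u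
  ...   | p , eq rewrite blocks-∷ a u (prefix-∷ a u eq) = cong suc (length-blocks u j≤u)

  blocks-injective : ∀ u u′ → length u ≡ length u′ → suc j ≤ length u →
                     blocks u ≡ blocks u′ → u ≡ u′
  blocks-injective (a ∷ u) (a′ ∷ u′) len (s≤s j≤u) eq
    with prefix-just j u j≤u | prefix-just j u′ (subst (j ≤_) (suc-injective len) j≤u)
  ... | p , e | p′ , e′
    with ∷-injective (trans (sym (blocks-∷ a u (prefix-∷ a u e)))
                            (trans eq (blocks-∷ a′ u′ (prefix-∷ a′ u′ e′))))
  ... | refl , eq′ with m≤n⇒m<n∨m≡n j≤u
  ...   | inj₁ j<u  = cong (a ∷_) (blocks-injective u u′ (suc-injective len) j<u eq′)
  ...   | inj₂ j≡u  = cong (a ∷_) (trans (prefix-whole j u (sym j≡u) e)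
                        (sym (prefix-whole j u′ (trans (sym (suc-injective len)) (sym j≡u)) e′)))

  blocks-∷ʳ : ∀ u → j ≤ length u →
              Σ (Vec A j) λ s → ∀ c → blocks (u ++ [ c ]) ≡ blocks u ++ [ s ∷ʳ c ]
  blocks-∷ʳ u j≤ with m≤n⇒m<n∨m≡n j≤
  ... | inj₂ j≡u with prefix-just j u j≤
  ...   | s , e = s , λ c → begin
          blocks (u ++ [ c ])   ≡⟨ blocks-exact (u ++ [ c ]) (trans (length-snoc u c) (cong suc (sym j≡u)))
                                     (prefix-∷ʳ j u c (sym j≡u) e) ⟩
          [ s ∷ʳ c ]            ≡⟨ cong (_++ [ s ∷ʳ c ]) (sym (blocks-short u (≤-reflexive (sym j≡u)))) ⟩
          blocks u ++ [ s ∷ʳ c ] ∎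
  blocks-∷ʳ (a ∷ u) j≤ | inj₁ (s≤s j≤u) with blocks-∷ʳ u j≤u | prefix-just j u j≤u
  ... | s , snoc | p , e = s , λ c → begin
          blocks (a ∷ u ++ [ c ])           ≡⟨ blocks-∷ a (u ++ [ c ]) (prefix-∷ a _ (prefix-++ j u [ c ] e)) ⟩
          (a ∷ᵥ p) ∷ blocks (u ++ [ c ])     ≡⟨ cong (_ ∷_) (snoc c) ⟩
          (a ∷ᵥ p) ∷ blocks u ++ [ s ∷ʳ c ]  ≡⟨ cong (_++ _) (sym (blocks-∷ a u (prefix-∷ a u e))) ⟩
          blocks (a ∷ u) ++ [ s ∷ʳ c ]      ∎

  blocks-∷-inverse : ∀ u u′ {p v} → suc j ≤ length u → length u′ ≡ suc (length u) →
                     prefix j u ≡ just p → blocks u′ ≡ v ∷ blocks u →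
                     u′ ≡ head v ∷ u × v ≡ head v ∷ᵥ p
  blocks-∷-inverse u (c ∷ u″) k≤u len e eq
    with prefix-just j u″ (subst (j ≤_) (sym (suc-injective len)) (≤-trans (n≤1+n j) k≤u))
  ... | p″ , e″ with ∷-injective (trans (sym (blocks-∷ c u″ (prefix-∷ c u″ e″))) eq)
  ... | refl , same-blocks
    with blocks-injective u″ u (suc-injective len)
           (subst (suc j ≤_) (sym (suc-injective len)) k≤u) same-blocks
  ... | refl with trans (sym e″) e
  ... | refl = refl , refl

  blocks-∷ʳ-inverse : ∀ u u′ {s v} → suc j ≤ length u → length u′ ≡ suc (length u) →
                      (∀ c → blocks (u ++ [ c ]) ≡ blocks u ++ [ s ∷ʳ c ]) →
                      blocks u′ ≡ blocks u ++ [ v ] →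
                      u′ ≡ u ++ [ last v ] × v ≡ s ∷ʳ last v
  blocks-∷ʳ-inverse u u′ {s} k≤u len snoc eq with reverseView u′
  blocks-∷ʳ-inverse u u′ k≤u () snoc eq | []
  ... | u″ ∶ _ ∶ʳ c with suc-injective (trans (sym (length-snoc u″ c)) len)
  ... | len″ with blocks-∷ʳ u″ (subst (j ≤_) (sym len″) (≤-trans (n≤1+n j) k≤u))
  ... | s″ , snoc″ with ∷ʳ-injective (blocks u″) (blocks u) (trans (sym (snoc″ c)) eq)
  ... | same-blocks , refl
    with blocks-injective u″ u len″ (subst (suc j ≤_) (sym len″) k≤u) same-blocks
  ... | refl with vec-∷ʳ-injectiveˡ s″ s (∷ʳ-injectiveʳ (blocks u) (blocks u) (trans (sym (snoc″ c)) (snoc c)))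
  ... | refl rewrite last-∷ʳ c s = refl , refl

  blocks-around : ∀ u a b {p s} → prefix j u ≡ just p →
                  (∀ c → blocks (u ++ [ c ]) ≡ blocks u ++ [ s ∷ʳ c ]) →
                  blocks (a ∷ u ++ [ b ]) ≡ (a ∷ᵥ p) ∷ blocks u ++ [ s ∷ʳ b ]
  blocks-around u a b e snoc =
    trans (blocks-∷ a (u ++ [ b ]) (prefix-∷ a _ (prefix-++ j u [ b ] e))) (cong (_ ∷_) (snoc b))

offset-suc : ∀ i t → i ℤ.+ ℤ.+ suc t ≡ (i ℤ.+ ℤ.+ 1) ℤ.+ ℤ.+ t
offset-suc i t = sym (ℤ.+-assoc i (ℤ.+ 1) (ℤ.+ t))

module _ {A : Set} where

  window-suc : ∀ (x : Config A) i n → window x i (suc n) ≡ x i ∷ window x (i ℤ.+ ℤ.+ 1) n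
  window-suc x i n = begin
    map at (upTo (suc n))          ≡⟨ map-upTo at (suc n) ⟩
    at 0 ∷ applyUpTo (at ∘ suc) n  ≡⟨ cong₂ _∷_ (cong x (ℤ.+-identityʳ i)) (sym (map-upTo (at ∘ suc) n)) ⟩
    x i ∷ map (at ∘ suc) (upTo n)  ≡⟨ cong (x i ∷_) (map-cong (cong x ∘ offset-suc i) (upTo n)) ⟩
    x i ∷ window x (i ℤ.+ ℤ.+ 1) n ∎
    where
    at : ℕ → A
    at t = x (i ℤ.+ ℤ.+ t)

  length-window : ∀ (x : Config A) i n → length (window x i n) ≡ n
  length-window x i n = trans (length-map _ (upTo n)) (length-upTo n)

  γ-suc : ∀ m (x : Config A) i → γ (suc m) x i ≡ x i ∷ᵥ γ m x (i ℤ.+ ℤ.+ 1)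
  γ-suc m x i = cong₂ _∷ᵥ_ (cong x (ℤ.+-identityʳ i))
                  (tabulate-cong (cong x ∘ offset-suc i ∘ toℕ))

  prefix-window : ∀ (x : Config A) m n i → m ≤ n → prefix m (window x i n) ≡ just (γ m x i)
  prefix-window x zero    n       i _         = refl
  prefix-window x (suc m) (suc n) i (s≤s m≤n) = begin
    prefix (suc m) (window x i (suc n))                 ≡⟨ cong (prefix (suc m)) (window-suc x i n) ⟩
    prefix (suc m) (x i ∷ window x (i ℤ.+ ℤ.+ 1) n)     ≡⟨ prefix-∷ (x i) _ (prefix-window x m n (i ℤ.+ ℤ.+ 1) m≤n) ⟩
    just (x i ∷ᵥ γ m x (i ℤ.+ ℤ.+ 1))                   ≡⟨ cong just (sym (γ-suc m x i)) ⟩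
    just (γ (suc m) x i)                                ∎

module BlockLanguage {A : Set} (j : ℕ) (P : Subshift-like A) where
  open Blocks {A} j

  BlockImage : Subshift-like (Vec A (suc j))
  BlockImage y = Σ (Config A) λ x → P x × (∀ i → y i ≡ γ (suc j) x i)

  window-γ : ∀ (x : Config A) i m → window (γ (suc j) x) i m ≡ blocks (window x i (m + j))
  window-γ x i zero    = sym (blocks-short (window x i j) (≤-reflexive (length-window x i j)))
  window-γ x i (suc m) = begin
    window (γ (suc j) x) i (suc m)                        ≡⟨ window-suc (γ (suc j) x) i m ⟩
    γ (suc j) x i ∷ window (γ (suc j) x) i′ m             ≡⟨ cong (_ ∷_) (window-γ x i′ m) ⟩
    γ (suc j) x i ∷ blocks (window x i′ (m + j))          ≡⟨ sym (blocks-∷ (x i) _ first-block) ⟩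
    blocks (x i ∷ window x i′ (m + j))                    ≡⟨ cong blocks (sym (window-suc x i (m + j))) ⟩
    blocks (window x i (suc m + j))                       ∎
    where
    i′ : ℤ.ℤ
    i′ = i ℤ.+ ℤ.+ 1
    first-block : prefix (suc j) (x i ∷ window x i′ (m + j)) ≡ just (γ (suc j) x i)
    first-block = trans (prefix-∷ (x i) _ (prefix-window x j (m + j) i′ (m≤n+m j m)))
                        (cong just (sym (γ-suc j x i)))

  lang-blocks : ∀ {u} → Lang P u → j ≤ length u → Lang BlockImage (blocks u)
  lang-blocks {u} (x , x∈P , i , eq) j≤u = γ (suc j) x , (x , x∈P , λ _ → refl) , i , (begin
    window (γ (suc j) x) i (length (blocks u))     ≡⟨ window-γ x i _ ⟩
    blocks (window x i (length (blocks u) + j))    ≡⟨ cong (blocks ∘ window x i) (length-blocks u j≤u) ⟩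
    blocks (window x i (length u))                 ≡⟨ cong blocks eq ⟩
    blocks u                                       ∎)

  lang-preimage : ∀ {w} → Lang BlockImage w →
                  Σ (List A) λ u → Lang P u × blocks u ≡ w × length u ≡ length w + j
  lang-preimage {w} (y , (x , x∈P , y≡γx) , i , eq) =
    window x i (length w + j) ,
    (x , x∈P , i , cong (window x i) (length-window x i _)) ,
    (begin
      blocks (window x i (length w + j))  ≡⟨ sym (window-γ x i (length w)) ⟩
      window (γ (suc j) x) i (length w)   ≡⟨ map-cong (λ t → sym (y≡γx _)) (upTo (length w)) ⟩
      window y i (length w)               ≡⟨ eq ⟩
      w                                   ∎) ,
    length-window x i _

  lang-blocks⁻¹ : ∀ {u} → Lang BlockImage (blocks u) → suc j ≤ length u → Lang P u
  lang-blocks⁻¹ {u} L k≤u =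
    let u′ , L′ , same-blocks , len = lang-preimage L
        len′ = trans len (length-blocks u (≤-trans (n≤1+n j) k≤u))
    in subst (Lang P) (blocks-injective u′ u len′ (subst (suc j ≤_) (sym len′) k≤u) same-blocks) L′

module ExtensionGraphIso {A : Set} (j : ℕ) (P : Subshift-like A)
                         (u : List A) (k≤u : suc j ≤ length u) where
  open Blocks {A} j
  open BlockLanguage j P

  j≤u : j ≤ length u
  j≤u = ≤-trans (n≤1+n j) k≤u

  p : Vec A j
  p = proj₁ (prefix-just j u j≤u)

  p-prefix : prefix j u ≡ just p
  p-prefix = proj₂ (prefix-just j u j≤u)

  s : Vec A j
  s = proj₁ (blocks-∷ʳ u j≤u)

  s-suffix : ∀ c → blocks (u ++ [ c ]) ≡ blocks u ++ [ s ∷ʳ c ]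
  s-suffix = proj₂ (blocks-∷ʳ u j≤u)

  Ext : Graph (A ⊎ A)
  Ext = E₁ P u

  BlockExt : Graph (Vec A (suc j) ⊎ Vec A (suc j))
  BlockExt = E₁ BlockImage (blocks u)

  to : A ⊎ A → Vec A (suc j) ⊎ Vec A (suc j)
  to (inj₁ a) = inj₁ (a ∷ᵥ p)
  to (inj₂ b) = inj₂ (s ∷ʳ b)

  from : Vec A (suc j) ⊎ Vec A (suc j) → A ⊎ A
  from (inj₁ v) = inj₁ (head v)
  from (inj₂ v) = inj₂ (last v)

  left-extension : ∀ {v} → Lang BlockImage (v ∷ blocks u) →
                   Lang P (head v ∷ u) × v ≡ head v ∷ᵥ p
  left-extension L =
    let u′ , L′ , same-blocks , len = lang-preimage L
        u′≡ , v≡ = blocks-∷-inverse u u′ k≤u (trans len (cong suc (length-blocks u j≤u)))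
                     p-prefix same-blocks
    in subst (Lang P) u′≡ L′ , v≡

  right-extension : ∀ {v} → Lang BlockImage (blocks u ++ [ v ]) →
                    Lang P (u ++ [ last v ]) × v ≡ s ∷ʳ last v
  right-extension {v} L =
    let u′ , L′ , same-blocks , len = lang-preimage L
        len′ = trans len (trans (cong (_+ j) (length-snoc (blocks u) v))
                                (cong suc (length-blocks u j≤u)))
        u′≡ , v≡ = blocks-∷ʳ-inverse u u′ k≤u len′ s-suffix same-blocks
    in subst (Lang P) u′≡ L′ , v≡

  k≤around : ∀ a b → suc j ≤ length (a ∷ u ++ [ b ])
  k≤around a b = ≤-trans k≤u (≤-trans (length-++-≤ˡ u) (n≤1+n _))

  to-vert : ∀ {e} → Graph.Vert Ext e → Graph.Vert BlockExt (to e)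
  to-vert {inj₁ a} L = subst (Lang BlockImage) (blocks-∷ a u (prefix-∷ a u p-prefix))
                         (lang-blocks L (≤-trans j≤u (n≤1+n _)))
  to-vert {inj₂ b} L = subst (Lang BlockImage) (s-suffix b)
                         (lang-blocks L (≤-trans j≤u (length-++-≤ˡ u)))

  from-vert : ∀ {e} → Graph.Vert BlockExt e → Graph.Vert Ext (from e)
  from-vert {inj₁ v} L = proj₁ (left-extension L)
  from-vert {inj₂ v} L = proj₁ (right-extension L)

  from-to : ∀ {e} → Graph.Vert Ext e → from (to e) ≡ e
  from-to {inj₁ a} _ = refl
  from-to {inj₂ b} _ = cong inj₂ (last-∷ʳ b s)

  to-from : ∀ {e} → Graph.Vert BlockExt e → to (from e) ≡ e
  to-from {inj₁ v} L = cong inj₁ (sym (proj₂ (left-extension L)))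
  to-from {inj₂ v} L = cong inj₂ (sym (proj₂ (right-extension L)))

  to-edge : ∀ a b → Lang P (a ∷ u ++ [ b ]) →
            Lang BlockImage ((a ∷ᵥ p) ∷ blocks u ++ [ s ∷ʳ b ])
  to-edge a b L = subst (Lang BlockImage) (blocks-around u a b p-prefix s-suffix)
                    (lang-blocks L (≤-trans (n≤1+n j) (k≤around a b)))

  from-edge : ∀ {v v′} → Lang BlockImage (v ∷ blocks u) → Lang BlockImage (blocks u ++ [ v′ ]) →
              Lang BlockImage (v ∷ blocks u ++ [ v′ ]) → Lang P (head v ∷ u ++ [ last v′ ])
  from-edge {v} {v′} Lv Lv′ L = lang-blocks⁻¹ (subst (Lang BlockImage) around L) (k≤around (head v) (last v′))
    where
    around : v ∷ blocks u ++ [ v′ ] ≡ blocks (head v ∷ u ++ [ last v′ ])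
    around = trans (cong₂ (λ l r → l ∷ blocks u ++ [ r ])
                      (proj₂ (left-extension Lv)) (proj₂ (right-extension Lv′)))
                   (sym (blocks-around u _ _ p-prefix s-suffix))

  to-adj : ∀ {e e′} → Graph.Vert Ext e → Graph.Vert Ext e′ →
           Graph.Adj Ext e e′ → Graph.Adj BlockExt (to e) (to e′)
  to-adj {inj₁ a} {inj₂ b} _ _ L = to-edge a b L
  to-adj {inj₂ b} {inj₁ a} _ _ L = to-edge a b L
  to-adj {inj₁ _} {inj₁ _} _ _ ()
  to-adj {inj₂ _} {inj₂ _} _ _ ()

  from-adj : ∀ {e e′} → Graph.Vert BlockExt e → Graph.Vert BlockExt e′ →
             Graph.Adj BlockExt e e′ → Graph.Adj Ext (from e) (from e′)
  from-adj {inj₁ v} {inj₂ v′} Lv Lv′ L = from-edge Lv Lv′ L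
  from-adj {inj₂ v′} {inj₁ v} Lv′ Lv L = from-edge Lv Lv′ L
  from-adj {inj₁ _} {inj₁ _} _ _ ()
  from-adj {inj₂ _} {inj₂ _} _ _ ()

  extension-iso : GraphIso Ext BlockExt
  extension-iso = record
    { to = to ; from = from
    ; to-vert = λ {e} → to-vert {e} ; from-vert = λ {e} → from-vert {e}
    ; from-to = λ {e} → from-to {e} ; to-from = λ {e} → to-from {e}
    ; to-adj = λ {e} {e′} → to-adj {e} {e′} ; from-adj = λ {e} {e′} → from-adj {e} {e′} }

module _ {A : Set} (j : ℕ) (P : Subshift-like A) where
  open Blocks {A} j
  open BlockLanguage j P
  open ExtensionGraphIso j P using (extension-iso)

  -- A word u of length ≥ m + k has at least m blocks.
  dendric-descends : EventuallyDendric BlockImage → EventuallyDendric P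
  dendric-descends (m , dendric) = m + suc j , λ u m+k≤u Lu →
    let k≤u = ≤-trans (m≤n+m (suc j) m) m+k≤u
        j≤u = ≤-trans (n≤1+n j) k≤u
        m≤blocks = +-cancelʳ-≤ j m (length (blocks u))
                     (subst (m + j ≤_) (sym (length-blocks u j≤u))
                        (≤-trans (+-monoʳ-≤ m (n≤1+n j)) m+k≤u))
    in tree-transport (GraphIso-sym (extension-iso u k≤u))
         (dendric (blocks u) m≤blocks (lang-blocks Lu j≤u))

  -- A block word w of length ≥ m + 1 comes from a word of length |w| + j ≥ max(m, k).
  dendric-lifts : EventuallyDendric P → EventuallyDendric BlockImage
  dendric-lifts (m , dendric) = suc m , λ w 1+m≤w Lw →
    let u , Lu , blocks≡w , len = lang-preimage Lw
        k≤u = subst (suc j ≤_) (sym len) (≤-trans (s≤s (m≤n+m j m)) (+-monoˡ-≤ j 1+m≤w))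
        m≤u = subst (m ≤_) (sym len) (≤-trans (n≤1+n m) (≤-trans 1+m≤w (m≤m+n _ j)))
    in subst (λ w → IsTree (E₁ BlockImage w)) blocks≡w
         (tree-transport (extension-iso u k≤u) (dendric u m≤u Lu))

-- HigherBlock (j + 1) X is by definition the block image of the carrier of X.
lemma6p3 : (n : ℕ) (X : ShiftSpace (Fin n)) (k : ℕ) → 1 ≤ k →
    (EventuallyDendric (HigherBlock k X) ⇔ EventuallyDendric (ShiftSpace.carrier X))
lemma6p3 n X zero    ()
lemma6p3 n X (suc j) _  =
  mk⇔ (dendric-descends j (ShiftSpace.carrier X)) (dendric-lifts j (ShiftSpace.carrier X))
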